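{- Let $d$ be either $0$ or a positive square-free integer, $K=\mathbb{Q}(\sqrt{ -d})$, $R$ the ring of integers of $K$. (a) $\omega(\Gamma_{1,n})=2$ for all $n\geq1$. (b) $\omega(\Gamma^{un}_{2,n})=2n+1$ for all $n\geq1$.
   Context: $\omega(\cdot)$ denotes the clique number of a graph. The zero-divisor graph $\Gamma(M_2(R))$ is the directed graph whose vertices are the nonzero (left or right) zero-divisors of $M_2(R)$, with an edge $v_1\to v_2$ between distinct vertices iff $v_1v_2=0$. For an integer $N\geq1$ and $t\in R$, let $S_{tc,1,t,N}=\{\lambda\begin{bmatrix}1&t\\t^2&t^3\end{bmatrix}:\lambda\in\mathbb{Z},\,1\leq|\lambda|\leq N\}$ and $S_{tc,2,N}=\{\begin{bmatrix}0&0\\0&\lambda\end{bmatrix}:\lambda\in\mathbb{Z},\,1\leq|\lambda|\leq N\}$. Let $\Gamma_{1,N}$ be the induced subgraph of $\Gamma(M_2(R))$ on $S_{tc,1,0,N}\cup S_{tc,2,N}$, regarded as an undirected graph. Let $U=\{\pm1\}$ if $d\neq1,3$, $U=\{\pm1,\pm i\}$ if $d=1$ ($i=\sqrt{ -1}$), $U=\{\pm1,\pm\zeta,\pm\zeta^2\}$ if $d=3$ ($\zeta$ a primitive third root of unity); let $\Gamma_{2,N}$ be the induced subgraph of $\Gamma(M_2(R))$ on $\bigcup_{j\in U}S_{tc,1,j,N}$, and $\Gamma^{un}_{2,N}$ its underlying undirected graph (distinct $v_1,v_2$ adjacent iff $v_1v_2=0$ or $v_2v_1=0$). -}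

module Defs where

open import Data.Bool using (Bool; true; false; if_then_else_)
open import Data.Nat as ℕ using (ℕ; zero; suc; _≡ᵇ_; _%_; _/_)
open import Data.Integer as ℤ using (ℤ; +_; -_; ∣_∣)
open import Data.Product using (_×_; _,_; Σ; ∃; ∃-syntax)
open import Data.Sum using (_⊎_)
open import Data.List using (List; []; _∷_; length)
open import Data.List.Membership.Propositional using (_∈_)
open import Data.List.Relation.Unary.All using (All)
open import Data.List.Relation.Unary.AllPairs using (AllPairs)
open import Relation.Binary.PropositionalEquality using (_≡_; _≢_)

-- The ring of integers R of K = ℚ(√-d), d = 0 or positive square-free,
-- given by its standard explicit ℤ-basis:
--   d = 0           : R = ℤ
--   d ≡ 3 (mod 4)   : R = ℤ[ω], ω = (1+√-d)/2,  ω² = ω - (1+d)/4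
--   otherwise (d>0) : R = ℤ[ω], ω = √-d,        ω² = -d
-- An element (a , b) of ℤ × ℤ stands for a + b ω (unique representation).

R : ℕ → Set
R zero    = ℤ
R (suc _) = ℤ × ℤ

three-mod-four : ℕ → Bool
three-mod-four d = (d % 4) ≡ᵇ 3

0R : (d : ℕ) → R d
0R zero    = + 0
0R (suc _) = (+ 0 , + 0)

ι : (d : ℕ) → ℤ → R d
ι zero    n = n
ι (suc _) n = (n , + 0)

1R : (d : ℕ) → R d
1R d = ι d (+ 1)

addR : (d : ℕ) → R d → R d → R d
addR zero    x y = x ℤ.+ y
addR (suc _) (a , b) (c , e) = (a ℤ.+ c , b ℤ.+ e)

negR : (d : ℕ) → R d → R d
negR zero    x = ℤ.- x
negR (suc _) (a , b) = (ℤ.- a , ℤ.- b)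

mulR : (d : ℕ) → R d → R d → R d
mulR zero    x y = x ℤ.* y
mulR (suc n) (a , b) (c , e) =
  if three-mod-four (suc n)
  then ((a ℤ.* c) ℤ.- (+ ((suc n ℕ.+ 1) / 4)) ℤ.* (b ℤ.* e)
       , (a ℤ.* e) ℤ.+ (b ℤ.* c) ℤ.+ (b ℤ.* e))
  else ((a ℤ.* c) ℤ.- (+ (suc n)) ℤ.* (b ℤ.* e)
       , (a ℤ.* e) ℤ.+ (b ℤ.* c))

record M2 (A : Set) : Set where
  constructor mat
  field
    m11 m12 m21 m22 : A

open M2 public

_·_ : {d : ℕ} → M2 (R d) → M2 (R d) → M2 (R d)
_·_ {d} X Y = mat
  (addR d (mulR d (m11 X) (m11 Y)) (mulR d (m12 X) (m21 Y)))
  (addR d (mulR d (m11 X) (m12 Y)) (mulR d (m12 X) (m22 Y)))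
  (addR d (mulR d (m21 X) (m11 Y)) (mulR d (m22 X) (m21 Y)))
  (addR d (mulR d (m21 X) (m12 Y)) (mulR d (m22 X) (m22 Y)))

Zero : (d : ℕ) → M2 (R d)
Zero d = mat (0R d) (0R d) (0R d) (0R d)

scale : (d : ℕ) → ℤ → M2 (R d) → M2 (R d)
scale d l X = mat (mulR d (ι d l) (m11 X)) (mulR d (ι d l) (m12 X))
                  (mulR d (ι d l) (m21 X)) (mulR d (ι d l) (m22 X))

T : (d : ℕ) → R d → M2 (R d)
T d t = mat (1R d) t (mulR d t t) (mulR d t (mulR d t t))

InRange : ℕ → ℤ → Set
InRange N l = 1 ℕ.≤ ∣ l ∣ × ∣ l ∣ ℕ.≤ N

S1 : (d : ℕ) → R d → ℕ → M2 (R d) → Set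
S1 d t N X = ∃[ l ] (InRange N l × X ≡ scale d l (T d t))

S2 : (d : ℕ) → ℕ → M2 (R d) → Set
S2 d N X = ∃[ l ] (InRange N l × X ≡ mat (0R d) (0R d) (0R d) (ι d l))

U : (d : ℕ) → List (R d)
U 1 = 1R 1 ∷ negR 1 (1R 1) ∷ i ∷ negR 1 i ∷ []
  where i = (+ 0 , + 1)                 -- i = √-1
U 3 = 1R 3 ∷ negR 3 (1R 3) ∷ ζ ∷ negR 3 ζ ∷ mulR 3 ζ ζ ∷ negR 3 (mulR 3 ζ ζ) ∷ []
  where ζ = (ℤ.- + 1 , + 1)             -- ζ = ω - 1 = (-1+√-3)/2
U d = 1R d ∷ negR d (1R d) ∷ []

V1 : (d : ℕ) → ℕ → M2 (R d) → Set
V1 d N X = S1 d (0R d) N X ⊎ S2 d N X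

V2 : (d : ℕ) → ℕ → M2 (R d) → Set
V2 d N X = ∃[ j ] (j ∈ U d × S1 d j N X)

Adj : (d : ℕ) → M2 (R d) → M2 (R d) → Set
Adj d X Y = X ≢ Y × (X · Y ≡ Zero d ⊎ Y · X ≡ Zero d)

IsClique : {A : Set} → (A → Set) → (A → A → Set) → List A → Set
IsClique V E xs = All V xs × AllPairs E xs

CliqueNumber : {A : Set} → (A → Set) → (A → A → Set) → ℕ → Set
CliqueNumber {A} V E k =
  (∃[ xs ] (IsClique V E xs × length xs ≡ k))
  × (∀ (xs : List A) → IsClique V E xs → length xs ℕ.≤ k)

SquareFree : ℕ → Set
SquareFree d = ∀ (m : ℕ) → (m ℕ.* m) ∣ d → m ≡ 1
  where open import Data.Nat.Divisibility using (_∣_)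

-- Both bounds come from one pigeonhole argument: a clique has at most as many vertices as there are
-- colours in a colouring that separates adjacent vertices. Nonzero integer scalars never make a product
-- vanish, so λA and μB can only be adjacent when AB = 0 or BA = 0. In Γ_{1,n} every vertex is a multiple
-- of E₁₁ or of E₂₂, and these idempotents 2-colour the graph. In Γ_{2,n},
-- T(j) T(k) = (1 + j k²) [[1, k], [j², j² k]] vanishes iff j k² = −1; the multiples λ T(u) with u³ = −1 are
-- coloured by λ ∈ {±1, …, ±n}, the remaining units by 0 (and ±i by 1 when d = 1), which a finite check over
-- the units shows to be proper. T(1) together with the 2n multiples of T(−1) is a clique of size 2n + 1.
module Submission where

open import Defs
open import Data.Bool using (true; false; if_then_else_)
open import Data.Nat as ℕ using (ℕ; zero; suc; _≤_; _<_; _+_; _*_; z≤n; s≤s)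
import Data.Nat.Properties as ℕ
open import Data.Fin as Fin using (Fin; zero; suc; fromℕ<; toℕ)
import Data.Fin.Properties as Fin
open import Data.Integer as ℤ using (ℤ; +_; -[1+_])
import Data.Integer.Properties as ℤ
open import Data.Integer.Tactic.RingSolver using (solve-∀)
open import Data.Product using (_×_; _,_; proj₁; proj₂; ∃-syntax)
open import Data.Product.Properties using (≡-dec)
open import Data.Sum as Sum using (_⊎_; inj₁; inj₂; [_,_]′)
open import Data.Empty using (⊥-elim)
open import Data.List using (List; []; _∷_; length; lookup; map)
open import Data.List.Properties using (length-map)
open import Data.List.Membership.Propositional using (_∈_)
open import Data.List.Membership.Propositional.Properties using (∈-lookup)
open import Data.List.Relation.Unary.Any using (here; there)
open import Data.List.Relation.Unary.All as All using (All; []; _∷_; all?)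
import Data.List.Relation.Unary.All.Properties as All
open import Data.List.Relation.Unary.AllPairs as AllPairs using (AllPairs; []; _∷_)
import Data.List.Relation.Unary.AllPairs.Properties as AllPairs
open import Function using (id; _∘′_)
open import Relation.Binary.Definitions using (DecidableEquality)
open import Relation.Nullary using (¬_; Dec)
open import Relation.Nullary.Decidable using (isYes; map′; ¬?; _×-dec_; _⊎-dec_; True; toWitness)
open import Relation.Binary.PropositionalEquality

AllPairs-lookup : ∀ {A : Set} {R : A → A → Set} {xs : List A} → AllPairs R xs →
                  ∀ {i j : Fin (length xs)} → i Fin.< j → R (lookup xs i) (lookup xs j)
AllPairs-lookup (Rx ∷ _)  {zero}  {suc j} _         = All.lookup Rx (∈-lookup j)
AllPairs-lookup (_ ∷ Rxs) {suc i} {suc j} (s≤s i<j) = AllPairs-lookup Rxs i<j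

clique-length-≤-colours : ∀ {A : Set} {V : A → Set} {E : A → A → Set} {k : ℕ}
  (colour : ∀ {x} → V x → ℕ) → (∀ {x} (v : V x) → colour v < k) →
  (∀ {x y} (vx : V x) (vy : V y) → E x y → colour vx ≢ colour vy) →
  ∀ xs → IsClique V E xs → length xs ≤ k
clique-length-≤-colours {V = V} {k = k} colour colour<k proper xs (Vxs , Exs) =
  ℕ.≮⇒≥ λ k<length →
    let i , j , i<j , same = Fin.pigeonhole k<length fin-colour in
    proper (vertex i) (vertex j) (AllPairs-lookup Exs i<j) (begin
      colour (vertex i)    ≡⟨ Fin.toℕ-fromℕ< _ ⟨
      toℕ (fin-colour i)   ≡⟨ cong toℕ same ⟩
      toℕ (fin-colour j)   ≡⟨ Fin.toℕ-fromℕ< _ ⟩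
      colour (vertex j)    ∎)
  where
  open ≡-Reasoning
  vertex : (i : Fin (length xs)) → V (lookup xs i)
  vertex i = All.lookup Vxs (∈-lookup i)
  fin-colour : Fin (length xs) → Fin k
  fin-colour i = fromℕ< (colour<k (vertex i))

scaleR : (d : ℕ) → ℤ → R d → R d
scaleR zero    l x       = l ℤ.* x
scaleR (suc _) l (a , b) = (l ℤ.* a , l ℤ.* b)

-- Coordinatewise identities behind mulR; the ₃-variants are the case d ≡ 3 (mod 4), where
-- ω² = ω − (1+d)/4 adds b·e to the ω-coordinate.
private
  ι-re : ∀ l a b K → l ℤ.* a ℤ.- K ℤ.* (+ 0 ℤ.* b) ≡ l ℤ.* a
  ι-re = solve-∀
  ι-im : ∀ l a b → l ℤ.* b ℤ.+ + 0 ℤ.* a ≡ l ℤ.* b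
  ι-im = solve-∀
  ι-im₃ : ∀ l a b → l ℤ.* b ℤ.+ + 0 ℤ.* a ℤ.+ + 0 ℤ.* b ≡ l ℤ.* b
  ι-im₃ = solve-∀
  scale-re : ∀ l m a b c e K → (l ℤ.* a) ℤ.* (m ℤ.* c) ℤ.- K ℤ.* ((l ℤ.* b) ℤ.* (m ℤ.* e))
                             ≡ (l ℤ.* m) ℤ.* (a ℤ.* c ℤ.- K ℤ.* (b ℤ.* e))
  scale-re = solve-∀
  scale-im : ∀ l m a b c e → (l ℤ.* a) ℤ.* (m ℤ.* e) ℤ.+ (l ℤ.* b) ℤ.* (m ℤ.* c)
                           ≡ (l ℤ.* m) ℤ.* (a ℤ.* e ℤ.+ b ℤ.* c)
  scale-im = solve-∀
  scale-im₃ : ∀ l m a b c e → (l ℤ.* a) ℤ.* (m ℤ.* e) ℤ.+ (l ℤ.* b) ℤ.* (m ℤ.* c) ℤ.+ (l ℤ.* b) ℤ.* (m ℤ.* e)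
                            ≡ (l ℤ.* m) ℤ.* (a ℤ.* e ℤ.+ b ℤ.* c ℤ.+ b ℤ.* e)
  scale-im₃ = solve-∀
  scale-ℤ : ∀ l m a c → (l ℤ.* a) ℤ.* (m ℤ.* c) ≡ (l ℤ.* m) ℤ.* (a ℤ.* c)
  scale-ℤ = solve-∀

mulR-ι : ∀ d l x → mulR d (ι d l) x ≡ scaleR d l x
mulR-ι zero    l x = refl
mulR-ι (suc n) l (a , b) with three-mod-four (suc n)
... | true  = cong₂ _,_ (ι-re l a b (+ ((suc n ℕ.+ 1) ℕ./ 4))) (ι-im₃ l a b)
... | false = cong₂ _,_ (ι-re l a b (+ suc n)) (ι-im l a b)

mulR-scaleR : ∀ d l m x y → mulR d (scaleR d l x) (scaleR d m y) ≡ scaleR d (l ℤ.* m) (mulR d x y)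
mulR-scaleR zero    l m x y = scale-ℤ l m x y
mulR-scaleR (suc n) l m (a , b) (c , e) with three-mod-four (suc n)
... | true  = cong₂ _,_ (scale-re l m a b c e (+ ((suc n ℕ.+ 1) ℕ./ 4))) (scale-im₃ l m a b c e)
... | false = cong₂ _,_ (scale-re l m a b c e (+ suc n)) (scale-im l m a b c e)

addR-scaleR : ∀ d l x y → addR d (scaleR d l x) (scaleR d l y) ≡ scaleR d l (addR d x y)
addR-scaleR zero    l x y = sym (ℤ.*-distribˡ-+ l x y)
addR-scaleR (suc n) l (a , b) (c , e) = cong₂ _,_ (sym (ℤ.*-distribˡ-+ l a c)) (sym (ℤ.*-distribˡ-+ l b e))

scaleR-0R : ∀ d l → scaleR d l (0R d) ≡ 0R d
scaleR-0R zero    l = ℤ.*-zeroʳ l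
scaleR-0R (suc n) l = cong₂ _,_ (ℤ.*-zeroʳ l) (ℤ.*-zeroʳ l)

scaleR-cancel : ∀ d {l} x → l ≢ + 0 → scaleR d l x ≡ 0R d → x ≡ 0R d
scaleR-cancel zero    {l} x l≢0 lx≡0 = [ ⊥-elim ∘′ l≢0 , id ]′ (ℤ.i*j≡0⇒i≡0∨j≡0 l lx≡0)
scaleR-cancel (suc n) (a , b) l≢0 lx≡0 =
  cong₂ _,_ (scaleR-cancel zero a l≢0 (cong proj₁ lx≡0)) (scaleR-cancel zero b l≢0 (cong proj₂ lx≡0))

mulR-ι-ι : ∀ d a b → mulR d (ι d a) (ι d b) ≡ ι d (a ℤ.* b)
mulR-ι-ι zero    a b = refl
mulR-ι-ι (suc n) a b = trans (mulR-ι (suc n) a (b , + 0)) (cong (a ℤ.* b ,_) (ℤ.*-zeroʳ a))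

addR-ι-ι : ∀ d a b → addR d (ι d a) (ι d b) ≡ ι d (a ℤ.+ b)
addR-ι-ι zero    a b = refl
addR-ι-ι (suc n) a b = refl

ι-0 : ∀ d → ι d (+ 0) ≡ 0R d
ι-0 zero    = refl
ι-0 (suc n) = refl

ι-injective : ∀ d {a b} → ι d a ≡ ι d b → a ≡ b
ι-injective zero    a≡b = a≡b
ι-injective (suc n) a≡b = cong proj₁ a≡b

mat-cong : ∀ {A : Set} {a b c e a′ b′ c′ e′ : A} →
           a ≡ a′ → b ≡ b′ → c ≡ c′ → e ≡ e′ → mat a b c e ≡ mat a′ b′ c′ e′
mat-cong refl refl refl refl = refl

scale-· : ∀ d l m X Y → scale d l X · scale d m Y ≡ scale d (l ℤ.* m) (X · Y)
scale-· d l m (mat a b c e) (mat a′ b′ c′ e′) =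
  mat-cong (entry a a′ b c′) (entry a b′ b e′) (entry c a′ e c′) (entry c b′ e e′)
  where
  entry : ∀ x y z w → addR d (mulR d (mulR d (ι d l) x) (mulR d (ι d m) y))
                             (mulR d (mulR d (ι d l) z) (mulR d (ι d m) w))
                    ≡ mulR d (ι d (l ℤ.* m)) (addR d (mulR d x y) (mulR d z w))
  entry x y z w
    rewrite mulR-ι d l x | mulR-ι d m y | mulR-ι d l z | mulR-ι d m w
          | mulR-ι d (l ℤ.* m) (addR d (mulR d x y) (mulR d z w))
          | mulR-scaleR d l m x y | mulR-scaleR d l m z w
    = addR-scaleR d (l ℤ.* m) (mulR d x y) (mulR d z w)

scale-Zero : ∀ d l → scale d l (Zero d) ≡ Zero d
scale-Zero d l rewrite mulR-ι d l (0R d) | scaleR-0R d l = refl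

scale-cancel : ∀ d {l} X → l ≢ + 0 → scale d l X ≡ Zero d → X ≡ Zero d
scale-cancel d {l} (mat a b c e) l≢0 lX≡0 =
  mat-cong (entry a (cong m11 lX≡0)) (entry b (cong m12 lX≡0))
           (entry c (cong m21 lX≡0)) (entry e (cong m22 lX≡0))
  where
  entry : ∀ x → mulR d (ι d l) x ≡ 0R d → x ≡ 0R d
  entry x lx≡0 = scaleR-cancel d x l≢0 (trans (sym (mulR-ι d l x)) lx≡0)

scale-·-zero : ∀ d l m {A B} → A · B ≡ Zero d → scale d l A · scale d m B ≡ Zero d
scale-·-zero d l m {A} {B} AB≡0 = begin
  scale d l A · scale d m B    ≡⟨ scale-· d l m A B ⟩
  scale d (l ℤ.* m) (A · B)    ≡⟨ cong (scale d (l ℤ.* m)) AB≡0 ⟩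
  scale d (l ℤ.* m) (Zero d)   ≡⟨ scale-Zero d (l ℤ.* m) ⟩
  Zero d                       ∎
  where open ≡-Reasoning

scale-·-nonzero : ∀ d {l m A B} → l ≢ + 0 → m ≢ + 0 → A · B ≢ Zero d → scale d l A · scale d m B ≢ Zero d
scale-·-nonzero d {l} {m} {A} {B} l≢0 m≢0 AB≢0 =
  AB≢0 ∘′ scale-cancel d (A · B) lm≢0 ∘′ trans (sym (scale-· d l m A B))
  where
  lm≢0 : l ℤ.* m ≢ + 0
  lm≢0 = [ l≢0 , m≢0 ]′ ∘′ ℤ.i*j≡0⇒i≡0∨j≡0 l

scaled-nonadjacent : ∀ d {l m A B} → l ≢ + 0 → m ≢ + 0 → A · B ≢ Zero d → B · A ≢ Zero d →
                     ¬ Adj d (scale d l A) (scale d m B)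
scaled-nonadjacent d l≢0 m≢0 AB≢0 BA≢0 (_ , product≡0) =
  [ scale-·-nonzero d l≢0 m≢0 AB≢0 , scale-·-nonzero d m≢0 l≢0 BA≢0 ]′ product≡0

scale-T-injective : ∀ d {l m j k} → scale d l (T d j) ≡ scale d m (T d k) → l ≡ m
scale-T-injective d {l} {m} eq = begin
  l                           ≡⟨ ℤ.*-identityʳ l ⟨
  l ℤ.* + 1                   ≡⟨ ι-injective d (trans (sym (mulR-ι-ι d l (+ 1))) (trans (cong m11 eq) (mulR-ι-ι d m (+ 1)))) ⟩
  m ℤ.* + 1                   ≡⟨ ℤ.*-identityʳ m ⟩
  m                           ∎
  where open ≡-Reasoning

infixl 7 _·ℤ_
_·ℤ_ : M2 ℤ → M2 ℤ → M2 ℤ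
_·ℤ_ = _·_ {0}

ιM : (d : ℕ) → M2 ℤ → M2 (R d)
ιM d (mat a b c e) = mat (ι d a) (ι d b) (ι d c) (ι d e)

ιM-· : ∀ d A B → ιM d (A ·ℤ B) ≡ ιM d A · ιM d B
ιM-· d (mat a b c e) (mat a′ b′ c′ e′) =
  mat-cong (entry a a′ b c′) (entry a b′ b e′) (entry c a′ e c′) (entry c b′ e e′)
  where
  open ≡-Reasoning
  entry : ∀ x y z w → ι d (x ℤ.* y ℤ.+ z ℤ.* w) ≡ addR d (mulR d (ι d x) (ι d y)) (mulR d (ι d z) (ι d w))
  entry x y z w = begin
    ι d (x ℤ.* y ℤ.+ z ℤ.* w)                            ≡⟨ addR-ι-ι d (x ℤ.* y) (z ℤ.* w) ⟨
    addR d (ι d (x ℤ.* y)) (ι d (z ℤ.* w))               ≡⟨ cong₂ (addR d) (mulR-ι-ι d x y) (mulR-ι-ι d z w) ⟨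
    addR d (mulR d (ι d x) (ι d y)) (mulR d (ι d z) (ι d w)) ∎

ιM-Zero : ∀ d → ιM d (Zero 0) ≡ Zero d
ιM-Zero d rewrite ι-0 d = refl

ιM-injective : ∀ d {A B} → ιM d A ≡ ιM d B → A ≡ B
ιM-injective d {mat a b c e} {mat a′ b′ c′ e′} eq =
  mat-cong (ι-injective d (cong m11 eq)) (ι-injective d (cong m12 eq))
           (ι-injective d (cong m21 eq)) (ι-injective d (cong m22 eq))

ιM-·≡0⁺ : ∀ d {A B} → A ·ℤ B ≡ Zero 0 → ιM d A · ιM d B ≡ Zero d
ιM-·≡0⁺ d {A} {B} AB≡0 = trans (sym (ιM-· d A B)) (trans (cong (ιM d) AB≡0) (ιM-Zero d))

ιM-·≡0⁻ : ∀ d {A B} → ιM d A · ιM d B ≡ Zero d → A ·ℤ B ≡ Zero 0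
ιM-·≡0⁻ d {A} {B} eq = ιM-injective d (trans (ιM-· d A B) (trans eq (sym (ιM-Zero d))))

ιM-Adj⁺ : ∀ d {A B} → Adj 0 A B → Adj d (ιM d A) (ιM d B)
ιM-Adj⁺ d (A≢B , product≡0) = A≢B ∘′ ιM-injective d , Sum.map (ιM-·≡0⁺ d) (ιM-·≡0⁺ d) product≡0

ιM-Adj⁻ : ∀ d {A B} → Adj d (ιM d A) (ιM d B) → Adj 0 A B
ιM-Adj⁻ d (X≢Y , product≡0) = X≢Y ∘′ cong (ιM d) , Sum.map (ιM-·≡0⁻ d) (ιM-·≡0⁻ d) product≡0

scale-ιM : ∀ d l A → scale d l (ιM d A) ≡ ιM d (scale 0 l A)
scale-ιM d l (mat a b c e) = mat-cong (mulR-ι-ι d l a) (mulR-ι-ι d l b) (mulR-ι-ι d l c) (mulR-ι-ι d l e)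

T-ι : ∀ d a → T d (ι d a) ≡ ιM d (T 0 a)
T-ι d a rewrite mulR-ι-ι d a a | mulR-ι-ι d a (a ℤ.* a) = refl

negR-1R : ∀ d → negR d (1R d) ≡ ι d -[1+ 0 ]
negR-1R zero    = refl
negR-1R (suc n) = refl

T-ι-·-zero : ∀ d a b → T 0 a ·ℤ T 0 b ≡ Zero 0 → T d (ι d a) · T d (ι d b) ≡ Zero d
T-ι-·-zero d a b eq = subst₂ (λ X Y → X · Y ≡ Zero d) (sym (T-ι d a)) (sym (T-ι d b)) (ιM-·≡0⁺ d eq)

T-ι-·-nonzero : ∀ d a b → T 0 a ·ℤ T 0 b ≢ Zero 0 → T d (ι d a) · T d (ι d b) ≢ Zero d
T-ι-·-nonzero d a b ne = ne ∘′ ιM-·≡0⁻ d ∘′ subst₂ (λ X Y → X · Y ≡ Zero d) (T-ι d a) (T-ι d b)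

T[1]·T[1]≢0 : ∀ d → T d (1R d) · T d (1R d) ≢ Zero d
T[1]·T[1]≢0 d = T-ι-·-nonzero d (+ 1) (+ 1) λ ()

T[-1]·T[-1]≡0 : ∀ d → T d (negR d (1R d)) · T d (negR d (1R d)) ≡ Zero d
T[-1]·T[-1]≡0 d = subst (λ u → T d u · T d u ≡ Zero d) (sym (negR-1R d)) (T-ι-·-zero d -[1+ 0 ] -[1+ 0 ] refl)

T[-1]·T[1]≡0 : ∀ d → T d (negR d (1R d)) · T d (1R d) ≡ Zero d
T[-1]·T[1]≡0 d = subst (λ u → T d u · T d (1R d) ≡ Zero d) (sym (negR-1R d)) (T-ι-·-zero d -[1+ 0 ] (+ 1) refl)

InRange⇒≢0 : ∀ {n} l → InRange n l → l ≢ + 0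
InRange⇒≢0 _ (() , _) refl

E₁₁ E₂₂ : M2 ℤ
E₁₁ = mat (+ 1) (+ 0) (+ 0) (+ 0)
E₂₂ = mat (+ 0) (+ 0) (+ 0) (+ 1)

scaled-T[0] : ∀ d l → scale d l (T d (0R d)) ≡ ιM d (scale 0 l E₁₁)
scaled-T[0] d l = begin
  scale d l (T d (0R d))          ≡⟨ cong (λ o → scale d l (T d o)) (ι-0 d) ⟨
  scale d l (T d (ι d (+ 0)))     ≡⟨ cong (scale d l) (T-ι d (+ 0)) ⟩
  scale d l (ιM d (T 0 (+ 0)))    ≡⟨ scale-ιM d l (T 0 (+ 0)) ⟩
  ιM d (scale 0 l E₁₁)            ∎
  where open ≡-Reasoning

scaled-E₂₂ : ∀ d l → mat (0R d) (0R d) (0R d) (ι d l) ≡ ιM d (scale 0 l E₂₂)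
scaled-E₂₂ d l rewrite ℤ.*-zeroʳ l | ℤ.*-identityʳ l | ι-0 d = refl

side : ∀ {d n X} → V1 d n X → ℕ
side (inj₁ _) = 0
side (inj₂ _) = 1

side-proper : ∀ d n {X Y} (vX : V1 d n X) (vY : V1 d n Y) → Adj d X Y → side vX ≢ side vY
side-proper d n (inj₁ (l , rl , refl)) (inj₁ (m , rm , refl)) adj _ =
  scaled-nonadjacent 0 (InRange⇒≢0 l rl) (InRange⇒≢0 m rm) (λ ()) (λ ())
    (ιM-Adj⁻ d (subst₂ (Adj d) (scaled-T[0] d l) (scaled-T[0] d m) adj))
side-proper d n (inj₂ (l , rl , refl)) (inj₂ (m , rm , refl)) adj _ =
  scaled-nonadjacent 0 (InRange⇒≢0 l rl) (InRange⇒≢0 m rm) (λ ()) (λ ())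
    (ιM-Adj⁻ d (subst₂ (Adj d) (scaled-E₂₂ d l) (scaled-E₂₂ d m) adj))
side-proper d n (inj₁ _) (inj₂ _) _ ()
side-proper d n (inj₂ _) (inj₁ _) _ ()

clique-number-Γ₁ : ∀ d n → 1 ≤ n → CliqueNumber (V1 d n) (Adj d) 2
clique-number-Γ₁ d n 1≤n =
  (ιM d E₁₁ ∷ ιM d E₂₂ ∷ [] ,
   (inj₁ (+ 1 , one , sym (scaled-T[0] d (+ 1))) ∷ inj₂ (+ 1 , one , sym (scaled-E₂₂ d (+ 1))) ∷ [] ,
    (ιM-Adj⁺ d ((λ ()) , inj₁ refl) ∷ []) ∷ [] ∷ []) ,
   refl) ,
  clique-length-≤-colours side (λ { (inj₁ _) → s≤s z≤n ; (inj₂ _) → s≤s (s≤s z≤n) }) (side-proper d n)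
  where
  one : InRange n (+ 1)
  one = ℕ.≤-refl , 1≤n

signedIndex : ℕ → ℤ → ℕ
signedIndex n (+ a)    = a
signedIndex n -[1+ b ] = n + suc b

signedIndex-≢0 : ∀ {n} l → InRange n l → signedIndex n l ≢ 0
signedIndex-≢0     (+ a)      (1≤a , _) a≡0 = ℕ.<-irrefl (sym a≡0) 1≤a
signedIndex-≢0 {n} -[1+ b ]   _         eq  = ℕ.1+n≢0 (trans (sym (ℕ.+-suc n b)) eq)

signedIndex-≤ : ∀ {n} l → InRange n l → signedIndex n l ≤ 2 * n
signedIndex-≤ {n} (+ a)      (_ , a≤n) = ℕ.≤-trans a≤n (ℕ.m≤m+n n (n + 0))
signedIndex-≤ {n} -[1+ b ]   (_ , b<n) = ℕ.+-monoʳ-≤ n (ℕ.≤-trans b<n (ℕ.m≤m+n n 0))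

signedIndex-injective : ∀ {n} l m → InRange n l → InRange n m → signedIndex n l ≡ signedIndex n m → l ≡ m
signedIndex-injective     (+ a)    (+ b)    _         _         eq = cong +_ eq
signedIndex-injective {n} (+ a)    -[1+ b ] (_ , a≤n) _         eq = ⊥-elim (ℕ.m+1+n≰m n (subst (_≤ n) eq a≤n))
signedIndex-injective {n} -[1+ a ] (+ b)    _         (_ , b≤n) eq = ⊥-elim (ℕ.m+1+n≰m n (subst (_≤ n) (sym eq) b≤n))
signedIndex-injective {n} -[1+ a ] -[1+ b ] _         _         eq = cong -[1+_] (ℕ.suc-injective (ℕ.+-cancelˡ-≡ n _ _ eq))

≟R : (d : ℕ) → DecidableEquality (R d)
≟R zero    = ℤ._≟_
≟R (suc _) = ≡-dec ℤ._≟_ ℤ._≟_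

≟M : (d : ℕ) → DecidableEquality (M2 (R d))
≟M d (mat a b c e) (mat a′ b′ c′ e′) =
  map′ (λ (p , q , r , s) → mat-cong p q r s) (λ eq → cong m11 eq , cong m12 eq , cong m21 eq , cong m22 eq)
       (≟R d a a′ ×-dec ≟R d b b′ ×-dec ≟R d c c′ ×-dec ≟R d e e′)

data UnitClass : Set where
  lone   : Fin 2 → UnitClass
  spread : UnitClass

-- A unit u with T u · T u ≡ 0 (that is, u³ = −1) is `spread`: its multiples form a clique, so they are
-- coloured by the scalar. These are −1, and for d = 3 also −ζ and −ζ²; the other units get a fixed colour.
unitClass : (d : ℕ) → R d → UnitClass
unitClass 1 j = if isYes (≟R 1 j (negR 1 (1R 1))) then spread
                else if isYes (≟R 1 j (1R 1)) then lone zero else lone (suc zero)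
unitClass 3 j = if isYes (≟M 3 (_·_ {3} (T 3 j) (T 3 j)) (Zero 3)) then spread else lone zero
unitClass d j = if isYes (≟R d j (negR d (1R d))) then spread else lone zero

colour : ℕ → UnitClass → ℤ → ℕ
colour n (lone c) l = toℕ c
colour n spread   l = signedIndex n l

colour-≤ : ∀ {n} a l → 1 ≤ n → InRange n l → colour n a l ≤ 2 * n
colour-≤ {n} (lone c) _ 1≤n _ = ℕ.≤-trans (Fin.toℕ≤pred[n] c) (ℕ.≤-trans 1≤n (ℕ.m≤m+n n (n + 0)))
colour-≤ {n} spread   l _   r = signedIndex-≤ l r

Separated : {A : Set} → UnitClass → UnitClass → A → A → Set
Separated spread   spread    j k = j ≡ k
Separated (lone c) (lone c′) j k = c ≢ c′
Separated (lone c) spread    j k = c ≡ zero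
Separated spread   (lone c)  j k = c ≡ zero

colour-clash : ∀ {A : Set} {n} a b l m {j k : A} → Separated a b j k → InRange n l → InRange n m →
               colour n a l ≡ colour n b m → j ≡ k × l ≡ m
colour-clash spread   spread   l m j≡k  rl rm eq = j≡k , signedIndex-injective l m rl rm eq
colour-clash (lone c) (lone _) _ _ c≢c′ _  _  eq = ⊥-elim (c≢c′ (Fin.toℕ-injective eq))
colour-clash (lone _) spread   _ m refl _  rm eq = ⊥-elim (signedIndex-≢0 m rm (sym eq))
colour-clash spread   (lone _) l _ refl rl _  eq = ⊥-elim (signedIndex-≢0 l rl eq)

NonadjacentUnits : (d : ℕ) → R d → R d → Set
NonadjacentUnits d j k = T d j · T d k ≢ Zero d × T d k · T d j ≢ Zero d

Compatible : (d : ℕ) → UnitClass → UnitClass → R d → R d → Set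
Compatible d a b j k = Separated a b j k ⊎ NonadjacentUnits d j k

compatible-colours-distinct : ∀ d n a b {j k} l m → Compatible d a b j k → InRange n l → InRange n m →
  Adj d (scale d l (T d j)) (scale d m (T d k)) → colour n a l ≢ colour n b m
compatible-colours-distinct d n a b l m (inj₁ separated) rl rm (X≢Y , _) eq
  with refl , refl ← colour-clash a b l m separated rl rm eq = X≢Y refl
compatible-colours-distinct d n a b l m (inj₂ (jk≢0 , kj≢0)) rl rm adj _ =
  scaled-nonadjacent d (InRange⇒≢0 l rl) (InRange⇒≢0 m rm) jk≢0 kj≢0 adj

separated? : ∀ d a b (j k : R d) → Dec (Separated a b j k)
separated? d spread   spread    j k = ≟R d j k
separated? d (lone c) (lone c′) _ _ = ¬? (c Fin.≟ c′)
separated? d (lone c) spread    _ _ = c Fin.≟ zero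
separated? d spread   (lone c)  _ _ = c Fin.≟ zero

compatible? : ∀ d a b j k → Dec (Compatible d a b j k)
compatible? d a b j k =
  separated? d a b j k ⊎-dec ¬? (≟M d (T d j · T d k) (Zero d)) ×-dec ¬? (≟M d (T d k · T d j) (Zero d))

UnitsCompatible : ℕ → Set
UnitsCompatible d = All (λ j → All (λ k → Compatible d (unitClass d j) (unitClass d k) j k) (U d)) (U d)

unitsCompatible? : ∀ d → Dec (UnitsCompatible d)
unitsCompatible? d = all? (λ j → all? (λ k → compatible? d _ _ j k) (U d)) (U d)

compatible-by-computation : ∀ d → True (unitsCompatible? d) →
  ∀ {j k} → j ∈ U d → k ∈ U d → Compatible d (unitClass d j) (unitClass d k) j k
compatible-by-computation d ok j∈U k∈U = All.lookup (All.lookup (toWitness ok) j∈U) k∈U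

compatible : ∀ d {j k} → j ∈ U d → k ∈ U d → Compatible d (unitClass d j) (unitClass d k) j k
compatible 0 = compatible-by-computation 0 _
compatible 1 = compatible-by-computation 1 _
compatible 2 = compatible-by-computation 2 _
compatible 3 = compatible-by-computation 3 _
compatible d@(suc (suc (suc (suc _)))) (here refl)         (here refl)         = inj₂ (T[1]·T[1]≢0 d , T[1]·T[1]≢0 d)
compatible d@(suc (suc (suc (suc _)))) (here refl)         (there (here refl)) = inj₁ refl
compatible d@(suc (suc (suc (suc _)))) (there (here refl)) (here refl)         = inj₁ refl
compatible d@(suc (suc (suc (suc _)))) (there (here refl)) (there (here refl)) = inj₁ refl

unitColour : ∀ {d n X} → V2 d n X → ℕ
unitColour {d} {n} (j , _ , l , _) = colour n (unitClass d j) l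

unitColour-< : ∀ {d n X} → 1 ≤ n → (v : V2 d n X) → unitColour v < 2 * n + 1
unitColour-< {d} {n} 1≤n (j , _ , l , r , _) =
  ℕ.≤-<-trans (colour-≤ (unitClass d j) l 1≤n r) (ℕ.m<m+n (2 * n) (s≤s z≤n))

unitColour-proper : ∀ d n {X Y} (vX : V2 d n X) (vY : V2 d n Y) → Adj d X Y → unitColour vX ≢ unitColour vY
unitColour-proper d n (j , j∈U , l , rl , refl) (k , k∈U , m , rm , refl) =
  compatible-colours-distinct d n (unitClass d j) (unitClass d k) l m (compatible d j∈U k∈U) rl rm

signedRange : ℕ → List ℤ
signedRange zero    = []
signedRange (suc k) = + suc k ∷ -[1+ k ] ∷ signedRange k

length-signedRange : ∀ k → length (signedRange k) ≡ 2 * k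
length-signedRange zero    = refl
length-signedRange (suc k) = trans (cong (suc ∘′ suc) (length-signedRange k)) (sym (ℕ.*-distribˡ-+ 2 1 k))

signedRange-InRange : ∀ {n} k → k ≤ n → All (InRange n) (signedRange k)
signedRange-InRange zero    _   = []
signedRange-InRange (suc k) k<n = (s≤s z≤n , k<n) ∷ (s≤s z≤n , k<n) ∷ signedRange-InRange k (ℕ.<⇒≤ k<n)

signedRange-distinct : ∀ k → AllPairs _≢_ (signedRange k)
signedRange-distinct zero    = []
signedRange-distinct (suc k) =
  ((λ ()) ∷ All.map (outside (+ suc k) refl) below) ∷ All.map (outside -[1+ k ] refl) below ∷ signedRange-distinct k
  where
  below : All (InRange k) (signedRange k)
  below = signedRange-InRange k ℕ.≤-refl
  outside : ∀ l {m} → ℤ.∣ l ∣ ≡ suc k → InRange k m → l ≢ m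
  outside l ∣l∣≡1+k (_ , ∣m∣≤k) refl = ℕ.n≮n k (subst (_≤ k) ∣l∣≡1+k ∣m∣≤k)

1R∈U : ∀ d → 1R d ∈ U d
1R∈U 0                             = here refl
1R∈U 1                             = here refl
1R∈U 2                             = here refl
1R∈U 3                             = here refl
1R∈U (suc (suc (suc (suc _))))     = here refl

-1R∈U : ∀ d → negR d (1R d) ∈ U d
-1R∈U 0                            = there (here refl)
-1R∈U 1                            = there (here refl)
-1R∈U 2                            = there (here refl)
-1R∈U 3                            = there (here refl)
-1R∈U (suc (suc (suc (suc _))))    = there (here refl)

T[1]≢scaled-T[-1] : ∀ d l → scale d (+ 1) (T d (1R d)) ≢ scale d l (T d (negR d (1R d)))
T[1]≢scaled-T[-1] d l eq with refl ← scale-T-injective d eq = 1≢-1 (ι-injective d (begin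
  ι d (+ 1)                              ≡⟨ mulR-ι-ι d (+ 1) (+ 1) ⟨
  mulR d (ι d (+ 1)) (1R d)              ≡⟨ cong m12 eq ⟩
  mulR d (ι d (+ 1)) (negR d (1R d))     ≡⟨ cong (mulR d (ι d (+ 1))) (negR-1R d) ⟩
  mulR d (ι d (+ 1)) (ι d -[1+ 0 ])      ≡⟨ mulR-ι-ι d (+ 1) -[1+ 0 ] ⟩
  ι d -[1+ 0 ]                           ∎))
  where
  open ≡-Reasoning
  1≢-1 : + 1 ≢ -[1+ 0 ]
  1≢-1 ()

large-clique-Γ₂ : ∀ d n → 1 ≤ n → ∃[ xs ] (IsClique (V2 d n) (Adj d) xs × length xs ≡ 2 * n + 1)
large-clique-Γ₂ d n 1≤n =
  T₁ ∷ map T₋ (signedRange n) ,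
  ((1R d , 1R∈U d , + 1 , (ℕ.≤-refl , 1≤n) , refl) ∷ All.map⁺ (All.map V2-T₋ ranges) ,
   All.map⁺ (All.tabulate λ {l} _ → T[1]≢scaled-T[-1] d l , inj₂ (scale-·-zero d l (+ 1) (T[-1]·T[1]≡0 d))) ∷
   AllPairs.map⁺ (AllPairs.map (λ {l} {m} l≢m → l≢m ∘′ scale-T-injective d ,
                                                inj₁ (scale-·-zero d l m (T[-1]·T[-1]≡0 d)))
                               (signedRange-distinct n))) ,
  trans (cong suc (trans (length-map T₋ (signedRange n)) (length-signedRange n))) (ℕ.+-comm 1 (2 * n))
  where
  T₁ : M2 (R d)
  T₁ = scale d (+ 1) (T d (1R d))
  T₋ : ℤ → M2 (R d)
  T₋ l = scale d l (T d (negR d (1R d)))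
  ranges : All (InRange n) (signedRange n)
  ranges = signedRange-InRange n ℕ.≤-refl
  V2-T₋ : ∀ {l} → InRange n l → V2 d n (T₋ l)
  V2-T₋ {l} r = negR d (1R d) , -1R∈U d , l , r , refl

clique-number-Γ₂ : ∀ d n → 1 ≤ n → CliqueNumber (V2 d n) (Adj d) (2 * n + 1)
clique-number-Γ₂ d n 1≤n =
  large-clique-Γ₂ d n 1≤n , clique-length-≤-colours unitColour (unitColour-< 1≤n) (unitColour-proper d n)

theorem3p19 : (d : ℕ) → (d ≡ 0 ⊎ (1 ≤ d × SquareFree d)) →
    ((n : ℕ) → 1 ≤ n → CliqueNumber (V1 d n) (Adj d) 2)
    × ((n : ℕ) → 1 ≤ n → CliqueNumber (V2 d n) (Adj d) (2 * n + 1))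
theorem3p19 d _ = clique-number-Γ₁ d , clique-number-Γ₂ d
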